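{- Let $G=(V,E)$ be a simple undirected graph with $n=|V|$ vertices and $m=|E|$ edges. Let $\bar m>0$ and $0<\varepsilon<1$, and set $$k=\sqrt{\frac{2n\sqrt{\bar m}}{\varepsilon}},\qquad k'=\min\left(k,\ \frac{\bar m}{\varepsilon k}\right).$$ Let $V_{L_2}=\{u\in V: k'<\deg(u)\le k\}$ and $V_H=\{u\in V:\deg(u)>k\}$. If $\bar m\ge \frac14 m$, then the number of edges of $G$ with one endpoint in $V_{L_2}\cup V_H$ and the other endpoint in $V_H$ is at most $64\varepsilon\bar m$.
   Context: All graphs are finite, simple and undirected; $\deg(u)$ denotes the degree of vertex $u$.
   Formalization: The parameters $\bar m$ and $\varepsilon$ are rational. -}

module Defs where

open import Data.Bool using (Bool; true; false; _∧_; _∨_; T)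
open import Data.Nat using (ℕ; _<_)
open import Data.Integer using (+_)
open import Data.Fin using (Fin)
open import Data.List using (List; length; filterᵇ; concatMap; map)
open import Data.List using () renaming (allFin to allFinL)
open import Data.Product using (_×_; _,_)
open import Data.Rational using (ℚ; _/_; _*_)
open import Data.Rational.Properties using (_<?_)
open import Relation.Binary.PropositionalEquality using (_≡_)
open import Relation.Nullary.Decidable using (⌊_⌋)
import Data.Fin as Fin

record Graph (n : ℕ) : Set where
  field
    adj   : Fin n → Fin n → Bool
    sym   : ∀ u v → adj u v ≡ adj v u
    irref : ∀ u → adj u u ≡ false
open Graph public

_<ᵇ_ : ℚ → ℚ → Bool
p <ᵇ q = ⌊ p <? q ⌋

ι : ℕ → ℚ
ι k = + k / 1

countᵇ : {A : Set} → (A → Bool) → List A → ℕ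
countᵇ p xs = length (filterᵇ p xs)

deg : ∀ {n} → Graph n → Fin n → ℕ
deg {n} G u = countᵇ (adj G u) (allFinL n)

pairs : (n : ℕ) → List (Fin n × Fin n)
pairs n = concatMap (λ i → map (λ j → i , j) (allFinL n)) (allFinL n)

unorderedPairs : (n : ℕ) → List (Fin n × Fin n)
unorderedPairs n = filterᵇ (λ { (i , j) → Data.Nat._<ᵇ_ (Fin.toℕ i) (Fin.toℕ j) }) (pairs n)
  where import Data.Nat

numEdges : ∀ {n} → Graph n → ℕ
numEdges {n} G = countᵇ (λ { (i , j) → adj G i j }) (unorderedPairs n)

-- Parameters: mbar (= m̄) and ε are rationals.
-- k  = sqrt (2 n sqrt(mbar) / ε),  k' = min (k , mbar / (ε k)).
-- For a degree d ≥ 0 (and mbar, ε > 0) we have, by squaring nonnegative quantities: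
--   d > k   ⇔  d² ε > 2 n sqrt(mbar)  ⇔  (d² ε)² > 4 n² mbar
--   d > mbar / (ε k)  ⇔  d ε k > mbar  ⇔  d² ε² k² > mbar²
--                     ⇔  2 n d² ε sqrt(mbar) > mbar²  ⇔  4 n² d⁴ ε² > mbar³
--   d > k'  ⇔  d > k  ∨  d > mbar / (ε k)
degAboveK : (n : ℕ) (mbar ε : ℚ) (d : ℕ) → Bool
degAboveK n mbar ε d =
  (ι 4 * ι n * ι n * mbar) <ᵇ ((ι d * ι d * ε) * (ι d * ι d * ε))

degAboveMbarOverεk : (n : ℕ) (mbar ε : ℚ) (d : ℕ) → Bool
degAboveMbarOverεk n mbar ε d =
  (mbar * mbar * mbar) <ᵇ (ι 4 * ι n * ι n * (ι d * ι d * ι d * ι d) * (ε * ε))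

degAboveK' : (n : ℕ) (mbar ε : ℚ) (d : ℕ) → Bool
degAboveK' n mbar ε d = degAboveK n mbar ε d ∨ degAboveMbarOverεk n mbar ε d

inVH : ∀ {n} → Graph n → ℚ → ℚ → Fin n → Bool
inVH {n} G mbar ε u = degAboveK n mbar ε (deg G u)

inVL2 : ∀ {n} → Graph n → ℚ → ℚ → Fin n → Bool
inVL2 {n} G mbar ε u =
  degAboveK' n mbar ε (deg G u) ∧ Data.Bool.not (degAboveK n mbar ε (deg G u))
  where import Data.Bool

crossEdges : ∀ {n} → Graph n → ℚ → ℚ → ℕ
crossEdges {n} G mbar ε = countᵇ ok (unorderedPairs n)
  where
  LH : Fin n → Bool
  LH u = inVL2 G mbar ε u ∨ inVH G mbar ε u
  ok : Fin n × Fin n → Bool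
  ok (i , j) = adj G i j ∧ ((LH i ∧ inVH G mbar ε j) ∨ (inVH G mbar ε i ∧ LH j))

module Submission where

-- Let a be the least degree in V_H and b the least degree in V_L2 ∪ V_H. Every counted edge
-- joins V_L2 ∪ V_H to V_H, so there are at most |V_L2 ∪ V_H| |V_H| of them, while the
-- handshake lemma gives |V_H| a ≤ 2m and |V_L2 ∪ V_H| b ≤ 2m; hence (#edges) a b ≤ 4m² ≤ 64 m̄².
-- It remains to see ε a b > m̄. If b > m̄/(εk), then ε a b > ε k m̄/(εk) = m̄. If b > k, then
-- ε a b > ε k² = 2n√m̄ ≥ m̄, because a ≤ n and a > k force m̄ < 4n².
-- Since k involves square roots, the thresholds are compared through fourth powers
-- (d > k iff (d²ε)² > 4n²m̄), so ε a b > m̄ is first proved for fourth powers.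

module FiniteSum where

  open import Defs using (countᵇ)
  open import Data.Bool using (Bool; true; false; _∧_; _∨_; T)
  open import Data.Product using (∃-syntax; _,_)
  open import Data.Sum using (_⊎_; inj₁; inj₂)
  open import Data.Nat
  open import Data.Nat.Properties
  open import Algebra.Properties.CommutativeSemigroup +-commutativeSemigroup using (interchange)
  open import Data.List using (List; []; _∷_; _++_; map; concatMap; filterᵇ)
  open import Relation.Binary.PropositionalEquality hiding ([_])

  ∑ : {A : Set} → List A → (A → ℕ) → ℕ
  ∑ []       f = 0
  ∑ (x ∷ xs) f = f x + ∑ xs f

  syntax ∑ xs (λ x → e) = ∑[ x ∈ xs ] e

  [_] : Bool → ℕ
  [ true  ] = 1
  [ false ] = 0

  [b]*x≤y : ∀ b {x y} → (T b → x ≤ y) → [ b ] * x ≤ y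
  [b]*x≤y true  {x} x≤y = ≤-trans (≤-reflexive (+-identityʳ x)) (x≤y _)
  [b]*x≤y false x≤y     = z≤n

  [a∧[x∨y]]≤[a∧x]+[a∧y] : ∀ a x y → [ a ∧ (x ∨ y) ] ≤ [ a ∧ x ] + [ a ∧ y ]
  [a∧[x∨y]]≤[a∧x]+[a∧y] false x     y = z≤n
  [a∧[x∨y]]≤[a∧x]+[a∧y] true  true  y = s≤s z≤n
  [a∧[x∨y]]≤[a∧x]+[a∧y] true  false y = ≤-refl

  [a∧[x∧y]]≤[x]*[y] : ∀ a x y → [ a ∧ (x ∧ y) ] ≤ [ x ] * [ y ]
  [a∧[x∧y]]≤[x]*[y] false x     y = z≤n
  [a∧[x∧y]]≤[x]*[y] true  false y = z≤n
  [a∧[x∧y]]≤[x]*[y] true  true  y = ≤-reflexive (sym (+-identityʳ [ y ]))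

  module _ {A : Set} where

    ∑-zero : ∀ (xs : List A) → ∑[ x ∈ xs ] 0 ≡ 0
    ∑-zero []       = refl
    ∑-zero (x ∷ xs) = ∑-zero xs

    ∑-cong : ∀ {f g : A → ℕ} xs → (∀ x → f x ≡ g x) → ∑ xs f ≡ ∑ xs g
    ∑-cong []       f≗g = refl
    ∑-cong (x ∷ xs) f≗g = cong₂ _+_ (f≗g x) (∑-cong xs f≗g)

    ∑-mono-≤ : ∀ {f g : A → ℕ} xs → (∀ x → f x ≤ g x) → ∑ xs f ≤ ∑ xs g
    ∑-mono-≤ []       f≤g = z≤n
    ∑-mono-≤ (x ∷ xs) f≤g = +-mono-≤ (f≤g x) (∑-mono-≤ xs f≤g)

    ∑-distrib-+ : ∀ (f g : A → ℕ) xs → ∑[ x ∈ xs ] (f x + g x) ≡ ∑ xs f + ∑ xs g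
    ∑-distrib-+ f g []       = refl
    ∑-distrib-+ f g (x ∷ xs) =
      trans (cong (f x + g x +_) (∑-distrib-+ f g xs)) (interchange (f x) (g x) (∑ xs f) (∑ xs g))

    *-distribʳ-∑ : ∀ (f : A → ℕ) c xs → ∑ xs f * c ≡ ∑[ x ∈ xs ] (f x * c)
    *-distribʳ-∑ f c []       = refl
    *-distribʳ-∑ f c (x ∷ xs) = trans (*-distribʳ-+ c (f x) (∑ xs f)) (cong (f x * c +_) (*-distribʳ-∑ f c xs))

    *-distribˡ-∑ : ∀ (f : A → ℕ) c xs → c * ∑ xs f ≡ ∑[ x ∈ xs ] (c * f x)
    *-distribˡ-∑ f c []       = *-zeroʳ c
    *-distribˡ-∑ f c (x ∷ xs) = trans (*-distribˡ-+ c (f x) (∑ xs f)) (cong (c * f x +_) (*-distribˡ-∑ f c xs))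

    ∑-++ : ∀ (f : A → ℕ) xs ys → ∑ (xs ++ ys) f ≡ ∑ xs f + ∑ ys f
    ∑-++ f []       ys = refl
    ∑-++ f (x ∷ xs) ys = trans (cong (f x +_) (∑-++ f xs ys)) (sym (+-assoc (f x) _ _))

    ∑-filterᵇ : ∀ (p : A → Bool) (f : A → ℕ) xs → ∑ (filterᵇ p xs) f ≡ ∑[ x ∈ xs ] ([ p x ] * f x)
    ∑-filterᵇ p f []       = refl
    ∑-filterᵇ p f (x ∷ xs) with p x
    ... | true  = cong₂ _+_ (sym (+-identityʳ (f x))) (∑-filterᵇ p f xs)
    ... | false = ∑-filterᵇ p f xs

    countᵇ≡∑ : ∀ (p : A → Bool) xs → countᵇ p xs ≡ ∑[ x ∈ xs ] [ p x ]
    countᵇ≡∑ p []       = refl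
    countᵇ≡∑ p (x ∷ xs) with p x
    ... | true  = cong suc (countᵇ≡∑ p xs)
    ... | false = countᵇ≡∑ p xs

    countᵇ≡0⊎∃ : ∀ (p : A → Bool) xs → countᵇ p xs ≡ 0 ⊎ ∃[ x ] T (p x)
    countᵇ≡0⊎∃ p []       = inj₁ refl
    countᵇ≡0⊎∃ p (x ∷ xs) with p x in px
    ... | true  = inj₂ (x , subst T (sym px) _)
    ... | false = countᵇ≡0⊎∃ p xs

  module _ {A B : Set} where

    ∑-map : ∀ (g : A → B) (f : B → ℕ) xs → ∑ (map g xs) f ≡ ∑[ x ∈ xs ] f (g x)
    ∑-map g f []       = refl
    ∑-map g f (x ∷ xs) = cong (f (g x) +_) (∑-map g f xs)

    ∑-concatMap : ∀ (g : A → List B) (f : B → ℕ) xs → ∑ (concatMap g xs) f ≡ ∑[ x ∈ xs ] ∑ (g x) f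
    ∑-concatMap g f []       = refl
    ∑-concatMap g f (x ∷ xs) = trans (∑-++ f (g x) (concatMap g xs)) (cong (∑ (g x) f +_) (∑-concatMap g f xs))

    ∑-comm : ∀ (f : A → B → ℕ) xs ys → ∑[ x ∈ xs ] ∑[ y ∈ ys ] f x y ≡ ∑[ y ∈ ys ] ∑[ x ∈ xs ] f x y
    ∑-comm f []       ys = sym (∑-zero ys)
    ∑-comm f (x ∷ xs) ys = trans (cong (∑ ys (f x) +_) (∑-comm f xs ys)) (sym (∑-distrib-+ (f x) _ ys))

module Counting where

  open import Defs hiding (sym; _<ᵇ_)
  open import Data.Bool using (Bool; true; false; _∧_; _∨_; T; T?)
  open import Data.Bool.Properties using (∧-comm)
  open import Data.Nat
  open import Data.Nat.Properties
  open import Data.Fin using (Fin; toℕ)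
  open import Data.Fin.Properties using (toℕ-injective)
  open import Data.List using ([]; _∷_; map; allFin)
  open import Data.List.Properties using (length-filter; length-tabulate)
  open import Data.List.Membership.Propositional using (_∈_)
  open import Function using (_∘_; id)
  open import Data.List.Relation.Unary.Any using (here; there)
  open import Data.Product using (∃-syntax; _×_; _,_)
  open import Relation.Nullary using (ofʸ; ofⁿ; contradiction; yes; no)
  open import Relation.Binary.PropositionalEquality hiding ([_])
  open FiniteSum

  minimiser : ∀ {A : Set} (P : A → Bool) (f : A → ℕ) {x₀} → T (P x₀) → ∀ xs →
              ∃[ x ] T (P x) × (∀ y → y ∈ xs → T (P y) → f x ≤ f y)
  minimiser P f Px₀ []       = _ , Px₀ , λ _ ()
  minimiser P f Px₀ (y ∷ ys) with minimiser P f Px₀ ys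
  ... | x , Px , x-min with f x ≤? f y | T? (P y)
  ...   | yes x≤y | _      = x , Px , λ { _ (here refl) _ → x≤y ; z (there z∈ys) Pz → x-min z z∈ys Pz }
  ...   | no  _   | no ¬Py = x , Px , λ { _ (here refl) Py → contradiction Py ¬Py ; z (there z∈ys) Pz → x-min z z∈ys Pz }
  ...   | no  x≰y | yes Py = y , Py , λ { _ (here refl) _ → ≤-refl
                                        ; z (there z∈ys) Pz → ≤-trans (<⇒≤ (≰⇒> x≰y)) (x-min z z∈ys Pz) }
  module _ {n : ℕ} where

    ∑² : (Fin n → Fin n → ℕ) → ℕ
    ∑² g = ∑[ i ∈ allFin n ] ∑[ j ∈ allFin n ] g i j

    ∑²-cong : ∀ {g h : Fin n → Fin n → ℕ} → (∀ i j → g i j ≡ h i j) → ∑² g ≡ ∑² h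
    ∑²-cong g≗h = ∑-cong (allFin n) (λ i → ∑-cong (allFin n) (g≗h i))

    ∑²-mono-≤ : ∀ {g h : Fin n → Fin n → ℕ} → (∀ i j → g i j ≤ h i j) → ∑² g ≤ ∑² h
    ∑²-mono-≤ g≤h = ∑-mono-≤ (allFin n) (λ i → ∑-mono-≤ (allFin n) (g≤h i))

    ∑²-distrib-+ : ∀ (g h : Fin n → Fin n → ℕ) → ∑² (λ i j → g i j + h i j) ≡ ∑² g + ∑² h
    ∑²-distrib-+ g h = trans (∑-cong (allFin n) (λ i → ∑-distrib-+ (g i) (h i) (allFin n)))
                             (∑-distrib-+ _ _ (allFin n))

    ∑²-transpose : ∀ (g : Fin n → Fin n → ℕ) → ∑² (λ i j → g j i) ≡ ∑² g
    ∑²-transpose g = ∑-comm (λ i j → g j i) (allFin n) (allFin n)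

    ∑²-product : ∀ (f h : Fin n → ℕ) → ∑² (λ i j → f i * h j) ≡ ∑ (allFin n) f * ∑ (allFin n) h
    ∑²-product f h = sym (trans (*-distribʳ-∑ f _ (allFin n))
                                (∑-cong (allFin n) (λ i → *-distribˡ-∑ h (f i) (allFin n))))

    _<ᶠ_ : Fin n → Fin n → Bool
    i <ᶠ j = toℕ i <ᵇ toℕ j

    split-by-order : ∀ (g : Fin n → Fin n → ℕ) → (∀ i → g i i ≡ 0) →
                     ∀ i j → [ i <ᶠ j ] * g i j + [ j <ᶠ i ] * g i j ≡ g i j
    split-by-order g g-diag i j
      with i <ᶠ j | <ᵇ-reflects-< (toℕ i) (toℕ j) | j <ᶠ i | <ᵇ-reflects-< (toℕ j) (toℕ i)
    ... | true  | ofʸ i<j | true  | ofʸ j<i = contradiction j<i (<-asym i<j)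
    ... | true  | _       | false | _       = trans (+-identityʳ _) (+-identityʳ _)
    ... | false | _       | true  | _       = +-identityʳ _
    ... | false | ofⁿ i≮j | false | ofⁿ j≮i = sym (trans (cong (g i) (sym i≡j)) (g-diag i))
      where
      i≡j : i ≡ j
      i≡j = toℕ-injective (≤-antisym (≮⇒≥ j≮i) (≮⇒≥ i≮j))

    ∑²-split-by-order : ∀ (g : Fin n → Fin n → ℕ) → (∀ i → g i i ≡ 0) →
                        ∑² g ≡ ∑² (λ i j → [ i <ᶠ j ] * g i j) + ∑² (λ i j → [ i <ᶠ j ] * g j i)
    ∑²-split-by-order g g-diag = begin
      ∑² g                                                        ≡⟨ ∑²-cong (split-by-order g g-diag) ⟨
      ∑² (λ i j → [ i <ᶠ j ] * g i j + [ j <ᶠ i ] * g i j)        ≡⟨ ∑²-distrib-+ _ _ ⟩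
      ∑² (λ i j → [ i <ᶠ j ] * g i j) + ∑² (λ i j → [ j <ᶠ i ] * g i j)
        ≡⟨ cong (∑² (λ i j → [ i <ᶠ j ] * g i j) +_) (∑²-transpose (λ i j → [ i <ᶠ j ] * g j i)) ⟩
      ∑² (λ i j → [ i <ᶠ j ] * g i j) + ∑² (λ i j → [ i <ᶠ j ] * g j i) ∎
      where open ≡-Reasoning

    countᵇ-unorderedPairs : ∀ p → countᵇ p (unorderedPairs n) ≡ ∑² (λ i j → [ i <ᶠ j ] * [ p (i , j) ])
    countᵇ-unorderedPairs p = begin
      countᵇ p (unorderedPairs n)                         ≡⟨ countᵇ≡∑ p (unorderedPairs n) ⟩
      ∑[ ij ∈ unorderedPairs n ] [ p ij ]                 ≡⟨ ∑-filterᵇ _ _ (pairs n) ⟩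
      ∑ (pairs n) (λ (i , j) → [ i <ᶠ j ] * [ p (i , j) ]) ≡⟨ ∑-concatMap _ _ (allFin n) ⟩
      ∑[ i ∈ allFin n ] ∑ (map (i ,_) (allFin n)) (λ (i , j) → [ i <ᶠ j ] * [ p (i , j) ])
        ≡⟨ ∑-cong (allFin n) (λ i → ∑-map _ _ (allFin n)) ⟩
      ∑² (λ i j → [ i <ᶠ j ] * [ p (i , j) ])             ∎
      where open ≡-Reasoning

    module _ (G : Graph n) where

      deg≤n : ∀ i → deg G i ≤ n
      deg≤n i = ≤-trans (length-filter (T? ∘ adj G i) (allFin n)) (≤-reflexive (length-tabulate id))

      handshake : ∑[ i ∈ allFin n ] deg G i ≡ 2 * numEdges G
      handshake = begin
        ∑[ i ∈ allFin n ] deg G i                    ≡⟨ ∑-cong (allFin n) (λ i → countᵇ≡∑ (adj G i) (allFin n)) ⟩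
        ∑² a                                         ≡⟨ ∑²-split-by-order a (λ i → cong [_] (irref G i)) ⟩
        ∑² (λ i j → [ i <ᶠ j ] * a i j) + ∑² (λ i j → [ i <ᶠ j ] * a j i)
          ≡⟨ cong (∑² (λ i j → [ i <ᶠ j ] * a i j) +_) (∑²-cong (λ i j → cong (λ b → [ i <ᶠ j ] * [ b ]) (Graph.sym G j i))) ⟩
        ∑² (λ i j → [ i <ᶠ j ] * a i j) + ∑² (λ i j → [ i <ᶠ j ] * a i j)
          ≡⟨ cong (λ m → m + m) (countᵇ-unorderedPairs _) ⟨
        numEdges G + numEdges G                      ≡⟨ cong (numEdges G +_) (+-identityʳ (numEdges G)) ⟨
        2 * numEdges G                               ∎
        where
        open ≡-Reasoning
        a : Fin n → Fin n → ℕ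
        a i j = [ adj G i j ]

      countᵇ*≤2*numEdges : ∀ (P : Fin n → Bool) d → (∀ i → T (P i) → d ≤ deg G i) →
                           countᵇ P (allFin n) * d ≤ 2 * numEdges G
      countᵇ*≤2*numEdges P d d≤deg = begin
        countᵇ P (allFin n) * d          ≡⟨ cong (_* d) (countᵇ≡∑ P (allFin n)) ⟩
        ∑[ i ∈ allFin n ] [ P i ] * d    ≡⟨ *-distribʳ-∑ _ d (allFin n) ⟩
        ∑[ i ∈ allFin n ] ([ P i ] * d)  ≤⟨ ∑-mono-≤ (allFin n) (λ i → [b]*x≤y (P i) (d≤deg i)) ⟩
        ∑[ i ∈ allFin n ] deg G i        ≡⟨ handshake ⟩
        2 * numEdges G                   ∎
        where open ≤-Reasoning

      edgesBetween : (P Q : Fin n → Bool) → ℕ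
      edgesBetween P Q = countᵇ (λ (i , j) → adj G i j ∧ ((P i ∧ Q j) ∨ (Q i ∧ P j))) (unorderedPairs n)

      edgesBetween≤ : ∀ P Q → edgesBetween P Q ≤ countᵇ P (allFin n) * countᵇ Q (allFin n)
      edgesBetween≤ P Q = begin
        edgesBetween P Q                                                   ≡⟨ countᵇ-unorderedPairs _ ⟩
        ∑² (λ i j → [ i <ᶠ j ] * [ adj G i j ∧ ((P i ∧ Q j) ∨ (Q i ∧ P j)) ]) ≤⟨ ∑²-mono-≤ split-edge ⟩
        ∑² (λ i j → [ i <ᶠ j ] * r i j + [ i <ᶠ j ] * r j i)               ≡⟨ ∑²-distrib-+ _ _ ⟩
        ∑² (λ i j → [ i <ᶠ j ] * r i j) + ∑² (λ i j → [ i <ᶠ j ] * r j i) ≡⟨ ∑²-split-by-order r r-diag ⟨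
        ∑² r                                                               ≤⟨ ∑²-mono-≤ (λ i j → [a∧[x∧y]]≤[x]*[y] (adj G i j) (P i) (Q j)) ⟩
        ∑² (λ i j → [ P i ] * [ Q j ])                                     ≡⟨ ∑²-product _ _ ⟩
        ∑[ i ∈ allFin n ] [ P i ] * ∑[ j ∈ allFin n ] [ Q j ]              ≡⟨ cong₂ _*_ (countᵇ≡∑ P (allFin n)) (countᵇ≡∑ Q (allFin n)) ⟨
        countᵇ P (allFin n) * countᵇ Q (allFin n)                          ∎
        where
        open ≤-Reasoning
        r : Fin n → Fin n → ℕ
        r i j = [ adj G i j ∧ (P i ∧ Q j) ]
        r-diag : ∀ i → r i i ≡ 0
        r-diag i = cong (λ b → [ b ∧ (P i ∧ Q i) ]) (irref G i)
        split-edge : ∀ i j → [ i <ᶠ j ] * [ adj G i j ∧ ((P i ∧ Q j) ∨ (Q i ∧ P j)) ]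
                             ≤ [ i <ᶠ j ] * r i j + [ i <ᶠ j ] * r j i
        split-edge i j rewrite Graph.sym G j i | ∧-comm (P j) (Q i) =
          ≤-trans (*-monoʳ-≤ [ i <ᶠ j ] ([a∧[x∨y]]≤[a∧x]+[a∧y] (adj G i j) (P i ∧ Q j) (Q i ∧ P j)))
                  (≤-reflexive (*-distribˡ-+ [ i <ᶠ j ] _ _))

      edgesBetween*≤ : ∀ P Q dP dQ → (∀ i → T (P i) → dP ≤ deg G i) → (∀ i → T (Q i) → dQ ≤ deg G i) →
                       edgesBetween P Q * (dP * dQ) ≤ (2 * numEdges G) * (2 * numEdges G)
      edgesBetween*≤ P Q dP dQ dP≤deg dQ≤deg = begin
        edgesBetween P Q * (dP * dQ)    ≤⟨ *-monoˡ-≤ (dP * dQ) (edgesBetween≤ P Q) ⟩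
        (#P * #Q) * (dP * dQ)           ≡⟨ [m*n]*[o*p]≡[m*o]*[n*p] #P #Q dP dQ ⟩
        (#P * dP) * (#Q * dQ)           ≤⟨ *-mono-≤ (countᵇ*≤2*numEdges P dP dP≤deg) (countᵇ*≤2*numEdges Q dQ dQ≤deg) ⟩
        (2 * numEdges G) * (2 * numEdges G) ∎
        where
        open ≤-Reasoning
        #P #Q : ℕ
        #P = countᵇ P (allFin n)
        #Q = countᵇ Q (allFin n)

open import Defs
open import Data.Nat using (ℕ)
open import Data.Rational using (ℚ; 0ℚ; 1ℚ; _<_; _≤_; _*_)
open import Data.Rational using (mkℚ; *≤*; nonNegative; positive)
open import Data.Rational.Properties
import Data.Nat as ℕ
import Data.Nat.Properties as ℕ
import Data.Nat.Coprimality as Coprimality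
import Data.Integer as ℤ
import Data.Integer.Properties as ℤ
open import Data.Bool using (Bool; true; false; T; not; _∧_; _∨_)
open import Data.Bool.Properties using (T-∨)
open import Data.Fin using (Fin)
open import Data.List using (allFin)
open import Data.List.Membership.Propositional.Properties using (∈-allFin)
open import Data.Maybe using (nothing)
open import Data.Product using (∃-syntax; _,_)
open import Data.Sum using (inj₁; inj₂; [_,_]′)
open import Function using (Equivalence)
open import Relation.Binary.PropositionalEquality using (_≡_; refl; cong; cong₂)
import Relation.Binary.PropositionalEquality as ≡
open import Relation.Nullary using (yes; no; contradiction)
open import Relation.Nullary.Decidable using (toWitness)
open import Tactic.RingSolver using (solve-∀)
import Tactic.RingSolver.Core.AlmostCommutativeRing as ACR
open FiniteSum using (countᵇ≡0⊎∃)
open Counting using (minimiser; deg≤n; edgesBetween≤; edgesBetween*≤)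

ℚ-ring : ACR.AlmostCommutativeRing _ _
ℚ-ring = ACR.fromCommutativeRing +-*-commutativeRing (λ _ → nothing)

ι≡mkℚ : ∀ k → ι k ≡ mkℚ (ℤ.+ k) 0 (Coprimality.sym (Coprimality.1-coprimeTo k))
ι≡mkℚ k = normalize-coprime _

ι-* : ∀ a b → ι (a ℕ.* b) ≡ ι a * ι b
ι-* a b rewrite ι≡mkℚ a | ι≡mkℚ b = /-cong {p₁ = ℤ.+ (a ℕ.* b)} {q₁ = 1} (ℤ.pos-* a b) refl

ι-mono-≤ : ∀ {a b} → a ℕ.≤ b → ι a ≤ ι b
ι-mono-≤ {a} {b} a≤b rewrite ι≡mkℚ a | ι≡mkℚ b = *≤* (ℤ.*-monoʳ-≤-nonNeg (ℤ.+ 1) (ℤ.+≤+ a≤b))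

0≤ι : ∀ a → 0ℚ ≤ ι a
0≤ι a = ι-mono-≤ {0} {a} ℕ.z≤n

0≤* : ∀ {p q} → 0ℚ ≤ p → 0ℚ ≤ q → 0ℚ ≤ p * q
0≤* {p} {q} 0≤p 0≤q = nonNegative⁻¹ (p * q) {{nonNeg*nonNeg⇒nonNeg p {{nonNegative 0≤p}} q {{nonNegative 0≤q}}}}

*-mono-≤-nonNeg : ∀ {p q r s} → 0ℚ ≤ p → 0ℚ ≤ r → p ≤ q → r ≤ s → p * r ≤ q * s
*-mono-≤-nonNeg {p} {q} {r} {s} 0≤p 0≤r p≤q r≤s =
  ≤-trans (*-monoʳ-≤-nonNeg r {{nonNegative 0≤r}} p≤q)
          (*-monoˡ-≤-nonNeg q {{nonNegative (≤-trans 0≤p p≤q)}} r≤s)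

*-mono-<-nonNeg : ∀ {p q r s} → 0ℚ ≤ p → 0ℚ ≤ r → p < q → r < s → p * r < q * s
*-mono-<-nonNeg {p} {q} {r} {s} 0≤p 0≤r p<q r<s =
  ≤-<-trans (*-monoʳ-≤-nonNeg r {{nonNegative 0≤r}} (<⇒≤ p<q))
            (*-monoʳ-<-pos q {{positive (≤-<-trans 0≤p p<q)}} r<s)

*-self-cancel-< : ∀ {p q} → 0ℚ ≤ q → p * p < q * q → p < q
*-self-cancel-< {p} {q} 0≤q p²<q² with p <? q
... | yes p<q = p<q
... | no  p≮q = contradiction (<-≤-trans p²<q² (*-mono-≤-nonNeg 0≤q 0≤q q≤p q≤p)) (<-irrefl refl)
  where
  q≤p : q ≤ p
  q≤p = ≮⇒≥ p≮q

<ᵇ⇒< : ∀ {p q} → T (p <ᵇ q) → p < q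
<ᵇ⇒< {p} {q} = toWitness {a? = p <? q}

degAboveK⇒mbar<4*n*n : ∀ n a {mbar ε} → 0ℚ ≤ ε → ε ≤ 1ℚ → a ℕ.≤ n →
                       T (degAboveK n mbar ε a) → mbar < ι 4 * ι n * ι n
degAboveK⇒mbar<4*n*n n a {mbar} {ε} 0≤ε ε≤1 a≤n a>k =
  *-cancelˡ-<-nonNeg N {{nonNegative 0≤N}} (begin-strict
    N * mbar  <⟨ <ᵇ⇒< a>k ⟩
    α * α     ≤⟨ *-mono-≤-nonNeg 0≤α 0≤α α≤N α≤N ⟩
    N * N     ∎)
  where
  open ≤-Reasoning
  N α : ℚ
  N = ι 4 * ι n * ι n
  α = ι a * ι a * ε
  0≤a² : 0ℚ ≤ ι a * ι a
  0≤a² = 0≤* (0≤ι a) (0≤ι a)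
  0≤N : 0ℚ ≤ N
  0≤N = 0≤* (0≤* (0≤ι 4) (0≤ι n)) (0≤ι n)
  0≤α : 0ℚ ≤ α
  0≤α = 0≤* 0≤a² 0≤ε
  α≤N : α ≤ N
  α≤N = begin
    ι a * ι a * ε      ≤⟨ *-monoˡ-≤-nonNeg (ι a * ι a) {{nonNegative 0≤a²}} ε≤1 ⟩
    ι a * ι a * 1ℚ     ≡⟨ *-identityʳ (ι a * ι a) ⟩
    ι a * ι a          ≤⟨ *-mono-≤-nonNeg (0≤ι a) (0≤ι a) (ι-mono-≤ a≤n) (ι-mono-≤ a≤n) ⟩
    ι n * ι n          ≡⟨ ι-* n n ⟨
    ι (n ℕ.* n)        ≤⟨ ι-mono-≤ (ℕ.*-monoˡ-≤ n (ℕ.m≤n*m n 4)) ⟩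
    ι (4 ℕ.* n ℕ.* n)  ≡⟨ ≡.trans (ι-* (4 ℕ.* n) n) (cong (_* ι n) (ι-* 4 n)) ⟩
    N                  ∎

private
  [b²e]²*[a²e]²≡[e*[b*a]]⁴ : ∀ e a b → ((b * b * e) * (b * b * e)) * ((a * a * e) * (a * a * e))
                                      ≡ ((e * (b * a)) * (e * (b * a))) * ((e * (b * a)) * (e * (b * a)))
  [b²e]²*[a²e]²≡[e*[b*a]]⁴ = solve-∀ ℚ-ring

  N*x⁴≡x³*[N*x] : ∀ N x → N * ((x * x) * (x * x)) ≡ (x * x * x) * (N * x)
  N*x⁴≡x³*[N*x] = solve-∀ ℚ-ring

  [N*b⁴*e²]*[a²e]²≡N*[e*[b*a]]⁴ : ∀ N e a b → (N * (b * b * b * b) * (e * e)) * ((a * a * e) * (a * a * e))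
                                              ≡ N * (((e * (b * a)) * (e * (b * a))) * ((e * (b * a)) * (e * (b * a))))
  [N*b⁴*e²]*[a²e]²≡N*[e*[b*a]]⁴ = solve-∀ ℚ-ring

mbar<ε*[b*a] : ∀ n a b {mbar ε} → 0ℚ ≤ mbar → 0ℚ ≤ ε → ε ≤ 1ℚ → a ℕ.≤ n →
               T (degAboveK' n mbar ε b) → T (degAboveK n mbar ε a) → mbar < ε * (ι b * ι a)
mbar<ε*[b*a] n a b {mbar} {ε} 0≤mbar 0≤ε ε≤1 a≤n b>k' a>k =
  *-self-cancel-< 0≤c (*-self-cancel-< (0≤* 0≤c 0≤c) mbar⁴<c⁴)
  where
  open ≤-Reasoning
  N c : ℚ
  N = ι 4 * ι n * ι n
  c = ε * (ι b * ι a)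
  α : ℕ → ℚ
  α d = ι d * ι d * ε
  0≤c : 0ℚ ≤ c
  0≤c = 0≤* 0≤ε (0≤* (0≤ι b) (0≤ι a))
  0≤N : 0ℚ ≤ N
  0≤N = 0≤* (0≤* (0≤ι 4) (0≤ι n)) (0≤ι n)
  0≤N*mbar : 0ℚ ≤ N * mbar
  0≤N*mbar = 0≤* 0≤N 0≤mbar
  mbar²≤N*mbar : mbar * mbar ≤ N * mbar
  mbar²≤N*mbar = *-monoʳ-≤-nonNeg mbar {{nonNegative 0≤mbar}} (<⇒≤ (degAboveK⇒mbar<4*n*n n a 0≤ε ε≤1 a≤n a>k))

  mbar⁴<c⁴ : (mbar * mbar) * (mbar * mbar) < (c * c) * (c * c)
  mbar⁴<c⁴ with Equivalence.to T-∨ b>k'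
  ... | inj₁ b>k = begin-strict
    (mbar * mbar) * (mbar * mbar)  ≤⟨ *-mono-≤-nonNeg 0≤mbar² 0≤mbar² mbar²≤N*mbar mbar²≤N*mbar ⟩
    (N * mbar) * (N * mbar)        <⟨ *-mono-<-nonNeg 0≤N*mbar 0≤N*mbar (<ᵇ⇒< b>k) (<ᵇ⇒< a>k) ⟩
    (α b * α b) * (α a * α a)      ≡⟨ [b²e]²*[a²e]²≡[e*[b*a]]⁴ ε (ι a) (ι b) ⟩
    (c * c) * (c * c)              ∎
    where
    0≤mbar² : 0ℚ ≤ mbar * mbar
    0≤mbar² = 0≤* 0≤mbar 0≤mbar
  ... | inj₂ b>mbar/εk = *-cancelˡ-<-nonNeg N {{nonNegative 0≤N}} (begin-strict
    N * ((mbar * mbar) * (mbar * mbar))                    ≡⟨ N*x⁴≡x³*[N*x] N mbar ⟩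
    (mbar * mbar * mbar) * (N * mbar)
      <⟨ *-mono-<-nonNeg (0≤* (0≤* 0≤mbar 0≤mbar) 0≤mbar) 0≤N*mbar (<ᵇ⇒< b>mbar/εk) (<ᵇ⇒< a>k) ⟩
    (N * (ι b * ι b * ι b * ι b) * (ε * ε)) * (α a * α a)  ≡⟨ [N*b⁴*e²]*[a²e]²≡N*[e*[b*a]]⁴ N ε (ι a) (ι b) ⟩
    N * ((c * c) * (c * c))                                ∎)

private
  e*[[u*[v*x]]*[u*[v*x]]]≡u*v*u*v*e*x*x : ∀ e x u v → e * ((u * (v * x)) * (u * (v * x))) ≡ u * v * u * v * e * x * x
  e*[[u*[v*x]]*[u*[v*x]]]≡u*v*u*v*e*x*x = solve-∀ ℚ-ring

  p*[e*q]≡e*[p*q] : ∀ p e q → p * (e * q) ≡ e * (p * q)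
  p*[e*q]≡e*[p*q] = solve-∀ ℚ-ring

ι[t]≤64*ε*mbar : ∀ t m a b {mbar ε} → 0ℚ < mbar → 0ℚ ≤ ε →
                 t ℕ.* (a ℕ.* b) ℕ.≤ (2 ℕ.* m) ℕ.* (2 ℕ.* m) → ι m ≤ ι 4 * mbar → mbar < ε * (ι a * ι b) →
                 ι t ≤ ι 64 * ε * mbar
ι[t]≤64*ε*mbar t m a b {mbar} {ε} 0<mbar 0≤ε t*ab≤[2m]² m≤4mbar mbar<εab =
  *-cancelʳ-≤-pos mbar {{positive 0<mbar}} (begin
    ι t * mbar                       ≤⟨ *-monoˡ-≤-nonNeg (ι t) {{nonNegative (0≤ι t)}} (<⇒≤ mbar<εab) ⟩
    ι t * (ε * (ι a * ι b))          ≡⟨ p*[e*q]≡e*[p*q] (ι t) ε (ι a * ι b) ⟩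
    ε * (ι t * (ι a * ι b))          ≡⟨ cong (ε *_) (≡.trans (ι-* t (a ℕ.* b)) (cong (ι t *_) (ι-* a b))) ⟨
    ε * ι (t ℕ.* (a ℕ.* b))          ≤⟨ ε*-mono (ι-mono-≤ t*ab≤[2m]²) ⟩
    ε * ι ((2 ℕ.* m) ℕ.* (2 ℕ.* m))  ≡⟨ cong (ε *_) (≡.trans (ι-* (2 ℕ.* m) _) (cong₂ _*_ (ι-* 2 m) (ι-* 2 m))) ⟩
    ε * ((ι 2 * ι m) * (ι 2 * ι m))  ≤⟨ ε*-mono (*-mono-≤-nonNeg 0≤2m 0≤2m 2m≤8mbar 2m≤8mbar) ⟩
    ε * ((ι 2 * (ι 4 * mbar)) * (ι 2 * (ι 4 * mbar)))
                                     ≡⟨ e*[[u*[v*x]]*[u*[v*x]]]≡u*v*u*v*e*x*x ε mbar (ι 2) (ι 4) ⟩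
    ι 64 * ε * mbar * mbar           ∎)
  where
  open ≤-Reasoning
  ε*-mono : ∀ {p q} → p ≤ q → ε * p ≤ ε * q
  ε*-mono = *-monoˡ-≤-nonNeg ε {{nonNegative 0≤ε}}
  0≤2m : 0ℚ ≤ ι 2 * ι m
  0≤2m = 0≤* (0≤ι 2) (0≤ι m)
  2m≤8mbar : ι 2 * ι m ≤ ι 2 * (ι 4 * mbar)
  2m≤8mbar = *-monoˡ-≤-nonNeg (ι 2) {{nonNegative (0≤ι 2)}} m≤4mbar

-- crossEdges G mbar ε unfolds to edgesBetween G (inVL2∪VH G mbar ε) (inVH G mbar ε).
inVL2∪VH : ∀ {n} → Graph n → ℚ → ℚ → Fin n → Bool
inVL2∪VH G mbar ε u = inVL2 G mbar ε u ∨ inVH G mbar ε u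

inVL2∪VH⇒degAboveK' : ∀ {n} (G : Graph n) mbar ε u → T (inVL2∪VH G mbar ε u) → T (degAboveK' n mbar ε (deg G u))
inVL2∪VH⇒degAboveK' {n} G mbar ε u = [[x∨y]∧¬x]∨x⇒x∨y (degAboveK n mbar ε (deg G u)) (degAboveMbarOverεk n mbar ε (deg G u))
  where
  [[x∨y]∧¬x]∨x⇒x∨y : ∀ x y → T (((x ∨ y) ∧ not x) ∨ x) → T (x ∨ y)
  [[x∨y]∧¬x]∨x⇒x∨y true  y     _ = _
  [[x∨y]∧¬x]∨x⇒x∨y false true  _ = _

lemma2p5 : (n : ℕ) (G : Graph n) (mbar ε : ℚ) →
    0ℚ < mbar → 0ℚ < ε → ε < 1ℚ →
    ι (numEdges G) ≤ ι 4 * mbar →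
    ι (crossEdges G mbar ε) ≤ ι 64 * ε * mbar
lemma2p5 n G mbar ε 0<mbar 0<ε ε<1 m≤4mbar =
  [ no-heavy-vertex , some-heavy-vertex ]′ (countᵇ≡0⊎∃ VH (allFin n))
  where
  VH VL2∪VH : Fin n → Bool
  VH = inVH G mbar ε
  VL2∪VH = inVL2∪VH G mbar ε

  no-heavy-vertex : countᵇ VH (allFin n) ≡ 0 → ι (crossEdges G mbar ε) ≤ ι 64 * ε * mbar
  no-heavy-vertex #VH≡0 = ≤-trans (ι-mono-≤ cross≤0) (0≤* (0≤* (0≤ι 64) (<⇒≤ 0<ε)) (<⇒≤ 0<mbar))
    where
    #VL2∪VH : ℕ
    #VL2∪VH = countᵇ VL2∪VH (allFin n)
    cross≤0 : crossEdges G mbar ε ℕ.≤ 0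
    cross≤0 = ℕ.≤-trans (edgesBetween≤ G VL2∪VH VH)
                        (ℕ.≤-reflexive (≡.trans (cong (#VL2∪VH ℕ.*_) #VH≡0) (ℕ.*-zeroʳ #VL2∪VH)))

  some-heavy-vertex : ∃[ x₀ ] T (VH x₀) → ι (crossEdges G mbar ε) ≤ ι 64 * ε * mbar
  some-heavy-vertex (x₀ , x₀∈VH) =
    let x , x∈VH , x-min = minimiser VH (deg G) x₀∈VH (allFin n)
        y , y∈VL2∪VH , y-min = minimiser VL2∪VH (deg G) (Equivalence.from T-∨ (inj₂ x₀∈VH)) (allFin n)
    in ι[t]≤64*ε*mbar (crossEdges G mbar ε) (numEdges G) (deg G y) (deg G x) 0<mbar (<⇒≤ 0<ε)
         (edgesBetween*≤ G VL2∪VH VH (deg G y) (deg G x) (λ i → y-min i (∈-allFin i)) (λ i → x-min i (∈-allFin i)))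
         m≤4mbar
         (mbar<ε*[b*a] n (deg G x) (deg G y) (<⇒≤ 0<mbar) (<⇒≤ 0<ε) (<⇒≤ ε<1) (deg≤n G x)
                       (inVL2∪VH⇒degAboveK' G mbar ε y y∈VL2∪VH) x∈VH)
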